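{- Let $G$ be a finite connected graph, $W$ a positive weight function on $G$, $v_0\in V(G)$, and $D$ a distribution on $G$ such that $D(s)\le W(s)$ for all $s\ne v_0$. Then $D$ covers $W$ if and only if $V_{\{v_0\}}(D)\ge V_{\{v_0\}}(W)$.
   Context: A distribution (or weight function) on $G$ is a function $V(G)\to\mathbb{Z}_{\ge 0}$; a positive weight function has all values $\ge 1$. For adjacent vertices $p,q$, a pebbling move removes two pebbles from $p$ and adds one pebble to $q$, allowed only if the result is nonnegative. $D$ covers $W$ if by a finite sequence of pebbling moves one can reach a distribution $D'$ with $D'(q)\ge W(q)$ for all $q$. For nonempty $S\subseteq V(G)$, $V_S(D)=\sum_{q\in V(G)} D(q)\,2^{d(q,S)}$ with $d(q,S)=\min_{r\in S}d(q,r)$, $d$ the graph distance. -}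

module Defs where

open import Data.Nat using (ℕ; zero; suc; _+_; _*_; _∸_; _^_; _≤_)
open import Data.Fin using (Fin; zero; suc)
open import Data.Product using (Σ; ∃; _×_; _,_)
open import Relation.Binary.PropositionalEquality using (_≡_; _≢_)
open import Relation.Binary.Construct.Closure.ReflexiveTransitive using (Star)
open import Relation.Nullary using (¬_)

record Graph : Set₁ where
  field
    n     : ℕ
    Adj   : Fin n → Fin n → Set
    sym   : ∀ {u v} → Adj u v → Adj v u
    irrefl : ∀ {u} → ¬ Adj u u

module _ (G : Graph) where
  open Graph G

  Vertex : Set
  Vertex = Fin n

  data Walk : Vertex → Vertex → ℕ → Set where
    nil  : ∀ {u} → Walk u u 0
    cons : ∀ {u w v k} → Adj u w → Walk w v k → Walk u v (suc k)

  Connected : Set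
  Connected = ∀ u v → ∃ λ k → Walk u v k

  IsDistance : (Vertex → Vertex → ℕ) → Set
  IsDistance d = ∀ u v → Walk u v (d u v) × (∀ k → Walk u v k → d u v ≤ k)

  Distribution : Set
  Distribution = Vertex → ℕ

  Positive : Distribution → Set
  Positive W = ∀ q → 1 ≤ W q

  Move : Distribution → Distribution → Set
  Move D D' = Σ Vertex λ p → Σ Vertex λ q →
    Adj p q × 2 ≤ D p × D' p ≡ D p ∸ 2 × D' q ≡ D q + 1 ×
    (∀ x → x ≢ p → x ≢ q → D' x ≡ D x)

  Covers : Distribution → Distribution → Set
  Covers D W = ∃ λ D' → Star Move D D' × (∀ q → W q ≤ D' q)

sumFin : ∀ {m} → (Fin m → ℕ) → ℕ
sumFin {zero}  f = 0
sumFin {suc m} f = f zero + sumFin (λ i → f (suc i))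

weightV : (G : Graph) → (Fin (Graph.n G) → Fin (Graph.n G) → ℕ) → Fin (Graph.n G) → (Fin (Graph.n G) → ℕ) → ℕ
weightV G d v0 D = sumFin (λ q → D q * 2 ^ d q v0)

-- Every pebbling move removes 2·2^{d(p,v0)} from V_{v0} and adds 2^{d(q,v0)} ≤ 2·2^{d(p,v0)},
-- so V_{v0} never increases and a covered W has V_{v0}(W) ≤ V_{v0}(D).  Conversely, while some
-- s ≠ v0 lacks a pebble, V_{v0}(W) ≤ V_{v0}(D) and D ≤ W off v0 leave at least 2^{d(s,v0)}
-- pebbles on v0, enough to push one pebble to s along a shortest walk.  That preserves V_{v0}
-- and the bound D ≤ W off v0, but loses 2^{d(s,v0)} − 1 ≥ 1 pebbles, so it terminates; at the
-- end D ≥ W off v0, and the potential inequality gives D(v0) ≥ W(v0).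
{-# OPTIONS --safe #-}
module Submission where

open import Defs
open import Data.Nat using (ℕ; zero; suc; _+_; _*_; _∸_; _^_; _≤_; _<_; z≤n; s≤s; _<?_)
open import Data.Nat.Properties hiding (_≟_)
open import Data.Nat.Induction using (<-wellFounded)
open import Algebra.Properties.CommutativeSemigroup +-commutativeSemigroup
  using (interchange; xy∙z≈xz∙y)
open import Data.Fin using (Fin; zero; suc; _≟_)
open import Data.Fin.Properties using (any?)
open import Data.Product using (∃; _×_; _,_; proj₁; proj₂)
open import Data.Empty using (⊥-elim)
open import Function using (_∘_)
open import Induction.WellFounded using (Acc; acc)
open import Relation.Binary.PropositionalEquality
open import Relation.Binary.Construct.Closure.ReflexiveTransitive using (Star; ε; _◅_; _◅◅_)
open import Relation.Nullary using (yes; no)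
open import Relation.Nullary.Decidable using (_×-dec_; ¬?)

pointMass : ∀ {m} → Fin m → ℕ → Fin m → ℕ
pointMass zero    a zero    = a
pointMass zero    a (suc x) = 0
pointMass (suc i) a zero    = 0
pointMass (suc i) a (suc x) = pointMass i a x

pointMass-self : ∀ {m} (i : Fin m) a → pointMass i a i ≡ a
pointMass-self zero    a = refl
pointMass-self (suc i) a = pointMass-self i a

pointMass-other : ∀ {m} {i x : Fin m} a → x ≢ i → pointMass i a x ≡ 0
pointMass-other {i = zero}  {zero}  a x≢i = ⊥-elim (x≢i refl)
pointMass-other {i = zero}  {suc x} a x≢i = refl
pointMass-other {i = suc i} {zero}  a x≢i = refl
pointMass-other {i = suc i} {suc x} a x≢i = pointMass-other a (x≢i ∘ cong suc)

pointMass-+ : ∀ {m} (i x : Fin m) a b → pointMass i (a + b) x ≡ pointMass i a x + pointMass i b x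
pointMass-+ zero    zero    a b = refl
pointMass-+ zero    (suc x) a b = refl
pointMass-+ (suc i) zero    a b = refl
pointMass-+ (suc i) (suc x) a b = pointMass-+ i x a b

pointMass-* : ∀ {m} (i x : Fin m) a (f : Fin m → ℕ) → pointMass i a x * f x ≡ pointMass i (a * f i) x
pointMass-* zero    zero    a f = refl
pointMass-* zero    (suc x) a f = refl
pointMass-* (suc i) zero    a f = refl
pointMass-* (suc i) (suc x) a f = pointMass-* i x a (f ∘ suc)

pointMass-≤ : ∀ {m} (i x : Fin m) {a} (f : Fin m → ℕ) → a ≤ f i → pointMass i a x ≤ f x
pointMass-≤ zero    zero    f a≤fi = a≤fi
pointMass-≤ zero    (suc x) f a≤fi = z≤n
pointMass-≤ (suc i) zero    f a≤fi = z≤n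
pointMass-≤ (suc i) (suc x) f a≤fi = pointMass-≤ i x (f ∘ suc) a≤fi

sumFin-zero : ∀ m → sumFin {m} (λ _ → 0) ≡ 0
sumFin-zero zero    = refl
sumFin-zero (suc m) = sumFin-zero m

sumFin-mono : ∀ {m} {f g : Fin m → ℕ} → (∀ x → f x ≤ g x) → sumFin f ≤ sumFin g
sumFin-mono {zero}  f≤g = z≤n
sumFin-mono {suc m} f≤g = +-mono-≤ (f≤g zero) (sumFin-mono (f≤g ∘ suc))

sumFin-+ : ∀ {m} (f g : Fin m → ℕ) → sumFin (λ x → f x + g x) ≡ sumFin f + sumFin g
sumFin-+ {zero}  f g = refl
sumFin-+ {suc m} f g = trans (cong (f zero + g zero +_) (sumFin-+ (f ∘ suc) (g ∘ suc)))
                             (interchange (f zero) (g zero) (sumFin (f ∘ suc)) (sumFin (g ∘ suc)))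

sumFin-pointMass : ∀ {m} (i : Fin m) a → sumFin (pointMass i a) ≡ a
sumFin-pointMass {suc m} zero    a = trans (cong (a +_) (sumFin-zero m)) (+-identityʳ a)
sumFin-pointMass {suc m} (suc i) a = sumFin-pointMass i a

sumFin-exchange-≤ : ∀ {m} {f g : Fin m → ℕ} i j {A B} →
                    (∀ x → f x + pointMass i A x ≤ g x + pointMass j B x) →
                    sumFin f + A ≤ sumFin g + B
sumFin-exchange-≤ {f = f} {g} i j {A} {B} le = begin
  sumFin f + A                             ≡⟨ cong (sumFin f +_) (sym (sumFin-pointMass i A)) ⟩
  sumFin f + sumFin (pointMass i A)        ≡⟨ sym (sumFin-+ f (pointMass i A)) ⟩
  sumFin (λ x → f x + pointMass i A x)     ≤⟨ sumFin-mono le ⟩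
  sumFin (λ x → g x + pointMass j B x)     ≡⟨ sumFin-+ g (pointMass j B) ⟩
  sumFin g + sumFin (pointMass j B)        ≡⟨ cong (sumFin g +_) (sumFin-pointMass j B) ⟩
  sumFin g + B                             ∎
  where open ≤-Reasoning

weightedSum : ∀ {m} → (Fin m → ℕ) → (Fin m → ℕ) → ℕ
weightedSum w D = sumFin (λ x → D x * w x)

+-balance-trans : ∀ x y z {α β γ} → y + α ≡ x + β → z + β ≡ y + γ → z + α ≡ x + γ
+-balance-trans x y z {α} {β} {γ} h₁ h₂ = +-cancelʳ-≡ β (z + α) (x + γ) (begin
  z + α + β   ≡⟨ xy∙z≈xz∙y z α β ⟩
  z + β + α   ≡⟨ cong (_+ α) h₂ ⟩
  y + γ + α   ≡⟨ xy∙z≈xz∙y y γ α ⟩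
  y + α + γ   ≡⟨ cong (_+ γ) h₁ ⟩
  x + β + γ   ≡⟨ xy∙z≈xz∙y x β γ ⟩
  x + γ + β   ∎)
  where open ≡-Reasoning

+-balance-+ : ∀ x y z {α α′ β β′} → y + α ≡ x + β → z + α′ ≡ y + β′ → z + (α + α′) ≡ x + (β + β′)
+-balance-+ x y z {α} {α′} {β} {β′} h₁ h₂ = begin
  z + (α + α′)   ≡⟨ cong (z +_) (+-comm α α′) ⟩
  z + (α′ + α)   ≡⟨ sym (+-assoc z α′ α) ⟩
  z + α′ + α     ≡⟨ cong (_+ α) h₂ ⟩
  y + β′ + α     ≡⟨ xy∙z≈xz∙y y β′ α ⟩
  y + α + β′     ≡⟨ cong (_+ β′) h₁ ⟩
  x + β + β′     ≡⟨ +-assoc x β β′ ⟩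
  x + (β + β′)   ∎
  where open ≡-Reasoning

-- D' is D with a pebbles taken from p and b pebbles put on q, phrased additively so that
-- no truncated subtraction occurs.
record Shift {m} (D D' : Fin m → ℕ) (p : Fin m) (a : ℕ) (q : Fin m) (b : ℕ) : Set where
  constructor shifted
  field balance : ∀ x → D' x + pointMass p a x ≡ D x + pointMass q b x

open Shift

module _ {m : ℕ} {D D' : Fin m → ℕ} {p q : Fin m} {a b : ℕ} where

  shift-trans : ∀ {D″} {r c} → Shift D D' p a q b → Shift D' D″ q b r c → Shift D D″ p a r c
  shift-trans {D″} sh₁ sh₂ = shifted λ x → +-balance-trans (D x) (D' x) (D″ x) (balance sh₁ x) (balance sh₂ x)

  shift-+ : ∀ {D″} {a′ b′} → Shift D D' p a q b → Shift D' D″ p a′ q b′ → Shift D D″ p (a + a′) q (b + b′)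
  shift-+ {D″} {a′} {b′} sh₁ sh₂ = shifted λ x →
    trans (cong (D″ x +_) (pointMass-+ p x a a′))
          (trans (+-balance-+ (D x) (D' x) (D″ x) (balance sh₁ x) (balance sh₂ x))
                 (cong (D x +_) (sym (pointMass-+ q x b b′))))

  shift-source : ∀ a′ → Shift D D' p a q b → a + a′ ≤ D p → a′ ≤ D' p
  shift-source a′ sh a+a′≤Dp = +-cancelʳ-≤ a a′ (D' p) (begin
    a′ + a                  ≡⟨ +-comm a′ a ⟩
    a + a′                  ≤⟨ a+a′≤Dp ⟩
    D p                     ≤⟨ m≤m+n (D p) _ ⟩
    D p + pointMass q b p   ≡⟨ sym (balance sh p) ⟩
    D' p + pointMass p a p  ≡⟨ cong (D' p +_) (pointMass-self p a) ⟩
    D' p + a                ∎)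
    where open ≤-Reasoning

  shift-target : Shift D D' p a q b → a ≤ D p → b ≤ D' q
  shift-target sh a≤Dp = +-cancelˡ-≤ (D q) b (D' q) (begin
    D q + b                 ≡⟨ cong (D q +_) (sym (pointMass-self q b)) ⟩
    D q + pointMass q b q   ≡⟨ sym (balance sh q) ⟩
    D' q + pointMass p a q  ≤⟨ +-monoʳ-≤ (D' q) (pointMass-≤ p q D a≤Dp) ⟩
    D' q + D q              ≡⟨ +-comm (D' q) (D q) ⟩
    D q + D' q              ∎)
    where open ≤-Reasoning

  shift-outside-source : ∀ x → Shift D D' p a q b → x ≢ p → D' x ≡ D x + pointMass q b x
  shift-outside-source x sh x≢p =
    trans (sym (trans (cong (D' x +_) (pointMass-other a x≢p)) (+-identityʳ (D' x)))) (balance sh x)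

  shift-scale : ∀ (w : Fin m → ℕ) → Shift D D' p a q b →
                Shift (λ x → D x * w x) (λ x → D' x * w x) p (a * w p) q (b * w q)
  shift-scale w sh = shifted λ x → begin
    D' x * w x + pointMass p (a * w p) x   ≡⟨ cong (D' x * w x +_) (sym (pointMass-* p x a w)) ⟩
    D' x * w x + pointMass p a x * w x     ≡⟨ sym (*-distribʳ-+ (w x) (D' x) _) ⟩
    (D' x + pointMass p a x) * w x         ≡⟨ cong (_* w x) (balance sh x) ⟩
    (D x + pointMass q b x) * w x          ≡⟨ *-distribʳ-+ (w x) (D x) _ ⟩
    D x * w x + pointMass q b x * w x      ≡⟨ cong (D x * w x +_) (pointMass-* q x b w) ⟩
    D x * w x + pointMass q (b * w q) x    ∎
    where open ≡-Reasoning

sumFin-shift : ∀ {m} {D D' : Fin m → ℕ} {p q a b} → Shift D D' p a q b → sumFin D' + a ≡ sumFin D + b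
sumFin-shift {p = p} {q} sh =
  ≤-antisym (sumFin-exchange-≤ p q (≤-reflexive ∘ balance sh))
            (sumFin-exchange-≤ q p (≤-reflexive ∘ sym ∘ balance sh))

weightedSum-shift : ∀ {m} {D D' : Fin m → ℕ} {p q a b} (w : Fin m → ℕ) → Shift D D' p a q b →
                    weightedSum w D' + a * w p ≡ weightedSum w D + b * w q
weightedSum-shift w sh = sumFin-shift (shift-scale w sh)

module _ (G : Graph) where
  open Graph G using (Adj; irrefl) renaming (sym to adj-sym)

  adj⇒≢ : ∀ {p q} → Adj p q → p ≢ q
  adj⇒≢ adj refl = irrefl adj

  move-shift : ∀ {D D' : Distribution G} {p q} → p ≢ q → 2 ≤ D p →
               D' p ≡ D p ∸ 2 → D' q ≡ D q + 1 → (∀ x → x ≢ p → x ≢ q → D' x ≡ D x) →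
               Shift D D' p 2 q 1
  move-shift {D} {D'} {p} {q} p≢q 2≤Dp D'p D'q D'x = shifted balance′
    where
      balance′ : ∀ x → D' x + pointMass p 2 x ≡ D x + pointMass q 1 x
      balance′ x with x ≟ p | x ≟ q
      ... | yes refl | _ = begin
        D' x + pointMass x 2 x   ≡⟨ cong₂ _+_ D'p (pointMass-self x 2) ⟩
        D x ∸ 2 + 2              ≡⟨ m∸n+n≡m 2≤Dp ⟩
        D x                      ≡⟨ sym (+-identityʳ (D x)) ⟩
        D x + 0                  ≡⟨ cong (D x +_) (sym (pointMass-other 1 p≢q)) ⟩
        D x + pointMass q 1 x    ∎
        where open ≡-Reasoning
      ... | no x≢p | yes refl = begin
        D' x + pointMass p 2 x   ≡⟨ cong₂ _+_ D'q (pointMass-other 2 x≢p) ⟩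
        D x + 1 + 0              ≡⟨ +-identityʳ (D x + 1) ⟩
        D x + 1                  ≡⟨ cong (D x +_) (sym (pointMass-self x 1)) ⟩
        D x + pointMass x 1 x    ∎
        where open ≡-Reasoning
      ... | no x≢p | no x≢q =
        cong₂ _+_ (D'x x x≢p x≢q) (trans (pointMass-other 2 x≢p) (sym (pointMass-other 1 x≢q)))

  pebblingMove : ∀ {p q} (D : Distribution G) → Adj p q → 2 ≤ D p →
                 ∃ λ D' → Move G D D' × Shift D D' p 2 q 1
  pebblingMove {p} {q} D adj 2≤Dp =
    D' , (p , q , adj , 2≤Dp , D'p , D'q , D'x) , move-shift (adj⇒≢ adj) 2≤Dp D'p D'q D'x
    where
      D' : Distribution G
      D' x = D x ∸ pointMass p 2 x + pointMass q 1 x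
      D'p : D' p ≡ D p ∸ 2
      D'p = trans (cong₂ _+_ (cong (D p ∸_) (pointMass-self p 2)) (pointMass-other 1 (adj⇒≢ adj)))
                  (+-identityʳ (D p ∸ 2))
      D'q : D' q ≡ D q + 1
      D'q = cong₂ _+_ (cong (D q ∸_) (pointMass-other 2 (adj⇒≢ (adj-sym adj)))) (pointMass-self q 1)
      D'x : ∀ x → x ≢ p → x ≢ q → D' x ≡ D x
      D'x x x≢p x≢q = trans (cong₂ _+_ (cong (D x ∸_) (pointMass-other 2 x≢p)) (pointMass-other 1 x≢q))
                            (+-identityʳ (D x))

  walk-nonempty : ∀ {u v k} → u ≢ v → Walk G u v k → 1 ≤ k
  walk-nonempty u≢v nil        = ⊥-elim (u≢v refl)
  walk-nonempty u≢v (cons _ _) = s≤s z≤n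

  -- One pebble on s is one move away from two pebbles on the next vertex of the walk.
  deliver : ∀ {s u k} (D : Distribution G) → Walk G s u k → 2 ^ k ≤ D u →
            ∃ λ D' → Star (Move G) D D' × Shift D D' u (2 ^ k) s 1
  deliver D nil _ = D , ε , shifted λ _ → refl
  deliver {s} {u} D (cons {k = k} adj walk) 2ᵏ⁺¹≤Du =
    let D₁ , D→D₁ , sh₁ = deliver D walk (m+n≤o⇒m≤o (2 ^ k) 2ᵏ⁺¹≤Du)
        D₂ , D₁→D₂ , sh₂ = deliver D₁ walk (shift-source (2 ^ k) sh₁ 2ᵏ+2ᵏ≤Du)
        sh₁₂ = shift-+ sh₁ sh₂
        D₃ , D₂→D₃ , sh₃ = pebblingMove D₂ (adj-sym adj) (shift-target sh₁₂ 2ᵏ+2ᵏ≤Du)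
    in D₃ , D→D₁ ◅◅ D₁→D₂ ◅◅ D₂→D₃ ◅ ε
          , subst (λ c → Shift D D₃ u c s 1) (sym 2ᵏ⁺¹≡2ᵏ+2ᵏ) (shift-trans sh₁₂ sh₃)
    where
      2ᵏ⁺¹≡2ᵏ+2ᵏ : 2 ^ suc k ≡ 2 ^ k + 2 ^ k
      2ᵏ⁺¹≡2ᵏ+2ᵏ = cong (2 ^ k +_) (+-identityʳ (2 ^ k))
      2ᵏ+2ᵏ≤Du : 2 ^ k + 2 ^ k ≤ D u
      2ᵏ+2ᵏ≤Du = subst (_≤ D u) 2ᵏ⁺¹≡2ᵏ+2ᵏ 2ᵏ⁺¹≤Du

module Potential (G : Graph) (d : Vertex G → Vertex G → ℕ) (dist : IsDistance G d) (v0 : Vertex G) where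
  open Graph G using (Adj) renaming (sym to adj-sym)

  weight : Vertex G → ℕ
  weight x = 2 ^ d x v0

  V : Distribution G → ℕ
  V = weightV G d v0

  weight-root : ∀ (D : Distribution G) → D v0 * weight v0 ≡ D v0
  weight-root D = trans (cong (λ k → D v0 * 2 ^ k) (n≤0⇒n≡0 (proj₂ (dist v0 v0) 0 nil))) (*-identityʳ (D v0))

  weight-adj : ∀ {p q} → Adj p q → weight q ≤ 2 * weight p
  weight-adj {p} {q} adj = ^-monoʳ-≤ 2 (proj₂ (dist q v0) _ (cons (adj-sym adj) (proj₁ (dist p v0))))

  move-V : ∀ {D D'} → Move G D D' → V D' ≤ V D
  move-V {D} {D'} (p , q , adj , 2≤Dp , D'p , D'q , D'x) = +-cancelʳ-≤ (2 * weight p) (V D') (V D) (begin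
    V D' + 2 * weight p   ≡⟨ weightedSum-shift weight (move-shift G (adj⇒≢ G adj) 2≤Dp D'p D'q D'x) ⟩
    V D + 1 * weight q    ≡⟨ cong (V D +_) (*-identityˡ (weight q)) ⟩
    V D + weight q        ≤⟨ +-monoʳ-≤ (V D) (weight-adj adj) ⟩
    V D + 2 * weight p    ∎)
    where open ≤-Reasoning

  reachable-V : ∀ {D D'} → Star (Move G) D D' → V D' ≤ V D
  reachable-V ε               = ≤-refl
  reachable-V (move ◅ moves) = ≤-trans (reachable-V moves) (move-V move)

  covers⇒V≤ : ∀ {D W} → Covers G D W → V W ≤ V D
  covers⇒V≤ (D' , D→D' , W≤D') = ≤-trans (sumFin-mono λ x → *-monoˡ-≤ (weight x) (W≤D' x)) (reachable-V D→D')

  module _ (W : Distribution G) where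

    Affordable : Distribution G → Set
    Affordable D = (∀ s → s ≢ v0 → D s ≤ W s) × V W ≤ V D

    root-budget : ∀ D i {A} → V W ≤ V D →
                  (∀ x → D x * weight x + pointMass i A x ≤ W x * weight x + pointMass v0 (D v0) x) →
                  A ≤ D v0
    root-budget D i {A} V≤ le = +-cancelˡ-≤ (V D) A (D v0) (begin
      V D + A      ≤⟨ sumFin-exchange-≤ i v0 le ⟩
      V W + D v0   ≤⟨ +-monoˡ-≤ (D v0) V≤ ⟩
      V D + D v0   ∎)
      where open ≤-Reasoning

    root-covered : ∀ {D} → Affordable D → W v0 ≤ D v0
    root-covered {D} (D≤W , V≤) = root-budget D v0 V≤ le
      where
        le : ∀ x → D x * weight x + pointMass v0 (W v0) x ≤ W x * weight x + pointMass v0 (D v0) x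
        le x with x ≟ v0
        ... | yes refl rewrite pointMass-self x (W x) | pointMass-self x (D x) | weight-root D | weight-root W =
          ≤-reflexive (+-comm (D x) (W x))
        ... | no x≢v0 rewrite pointMass-other (W v0) x≢v0 | pointMass-other (D v0) x≢v0 =
          +-monoˡ-≤ 0 (*-monoˡ-≤ (weight x) (D≤W x x≢v0))

    root-pays : ∀ {D s} → Affordable D → s ≢ v0 → D s < W s → weight s ≤ D v0
    root-pays {D} {s} (D≤W , V≤) s≢v0 Ds<Ws = root-budget D s V≤ le
      where
        le : ∀ x → D x * weight x + pointMass s (weight s) x ≤ W x * weight x + pointMass v0 (D v0) x
        le x with x ≟ s
        ... | yes refl rewrite pointMass-self x (weight x) | pointMass-other (D v0) s≢v0 = begin
          D x * weight x + weight x   ≡⟨ +-comm (D x * weight x) (weight x) ⟩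
          suc (D x) * weight x        ≤⟨ *-monoˡ-≤ (weight x) Ds<Ws ⟩
          W x * weight x              ≡⟨ sym (+-identityʳ (W x * weight x)) ⟩
          W x * weight x + 0          ∎
          where open ≤-Reasoning
        ... | no x≢s with x ≟ v0
        ...   | yes refl rewrite pointMass-other (weight s) x≢s | pointMass-self x (D x) | weight-root D =
          ≤-trans (≤-reflexive (+-identityʳ (D x))) (m≤n+m (D x) (W x * weight x))
        ...   | no x≢v0 rewrite pointMass-other (weight s) x≢s | pointMass-other (D v0) x≢v0 =
          +-monoˡ-≤ 0 (*-monoˡ-≤ (weight x) (D≤W x x≢v0))

    fill : ∀ {D s} → Affordable D → s ≢ v0 → D s < W s →
           ∃ λ D' → Star (Move G) D D' × Affordable D' × sumFin D' < sumFin D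
    fill {D} {s} affordable@(D≤W , V≤) s≢v0 Ds<Ws = D' , D→D' , (D'≤W , subst (V W ≤_) (sym V-kept) V≤) , fewer
      where
        walk = proj₁ (dist s v0)
        delivery = deliver G D walk (root-pays affordable s≢v0 Ds<Ws)
        D' = proj₁ delivery
        D→D' = proj₁ (proj₂ delivery)
        sh = proj₂ (proj₂ delivery)

        D+pebble≤W : ∀ x → x ≢ v0 → D x + pointMass s 1 x ≤ W x
        D+pebble≤W x x≢v0 with x ≟ s
        ... | yes refl rewrite pointMass-self x 1 | +-comm (D x) 1 = Ds<Ws
        ... | no x≢s rewrite pointMass-other 1 x≢s | +-identityʳ (D x) = D≤W x x≢v0

        D'≤W : ∀ x → x ≢ v0 → D' x ≤ W x
        D'≤W x x≢v0 = subst (_≤ W x) (sym (shift-outside-source x sh x≢v0)) (D+pebble≤W x x≢v0)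

        V-kept : V D' ≡ V D
        V-kept = +-cancelʳ-≡ (weight s) (V D') (V D) (begin
          V D' + weight s               ≡⟨ cong (V D' +_) (sym (weight-root (λ _ → weight s))) ⟩
          V D' + weight s * weight v0   ≡⟨ weightedSum-shift weight sh ⟩
          V D + 1 * weight s            ≡⟨ cong (V D +_) (*-identityˡ (weight s)) ⟩
          V D + weight s                ∎)
          where open ≡-Reasoning

        fewer : sumFin D' < sumFin D
        fewer = +-cancelʳ-≤ 1 (suc (sumFin D')) (sumFin D) (begin
          suc (sumFin D') + 1   ≡⟨ sym (+-suc (sumFin D') 1) ⟩
          sumFin D' + 2         ≤⟨ +-monoʳ-≤ (sumFin D') (^-monoʳ-≤ 2 (walk-nonempty G s≢v0 walk)) ⟩
          sumFin D' + weight s  ≡⟨ sumFin-shift sh ⟩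
          sumFin D + 1          ∎)
          where open ≤-Reasoning

    cover : ∀ {D} → Affordable D → Acc _<_ (sumFin D) → Covers G D W
    cover {D} affordable (acc smaller) with any? (λ s → ¬? (s ≟ v0) ×-dec (D s <? W s))
    ... | yes (s , s≢v0 , Ds<Ws) =
      let D' , D→D' , affordable' , fewer = fill affordable s≢v0 Ds<Ws
          D″ , D'→D″ , W≤D″ = cover affordable' (smaller fewer)
      in D″ , D→D' ◅◅ D'→D″ , W≤D″
    ... | no nothing-missing = D , ε , W≤D
      where
        W≤D : ∀ x → W x ≤ D x
        W≤D x with x ≟ v0
        ... | yes refl = root-covered affordable
        ... | no x≢v0  = ≮⇒≥ λ Dx<Wx → nothing-missing (x , x≢v0 , Dx<Wx)

lemma3 : (G : Graph) → Connected G →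
         (d : Fin (Graph.n G) → Fin (Graph.n G) → ℕ) → IsDistance G d →
         (W : Distribution G) → Positive G W →
         (v0 : Fin (Graph.n G)) → (D : Distribution G) →
         (∀ s → s ≢ v0 → D s ≤ W s) →
         (Covers G D W → weightV G d v0 W ≤ weightV G d v0 D)
           × (weightV G d v0 W ≤ weightV G d v0 D → Covers G D W)
lemma3 G _ d dist W _ v0 D D≤W = covers⇒V≤ , λ V≤ → cover W (D≤W , V≤) (<-wellFounded (sumFin D))
  where open Potential G d dist v0
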